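{- For all integers $n\ge 1$ and $m\ge 1$, the number of strict $(n,m)$-multiplicative types is $|\mathrm{Stp}(n,m)| = m^n$.
   Context: $\omega\cdot m$ denotes $\omega\times m$ ordered antilexicographically: $(a,\ell)<(b,\ell')$ iff $\ell<\ell'$, or $\ell=\ell'$ and $a<b$. For an order embedding $f:n=\{0<\dots<n-1\}\hookrightarrow\omega\cdot m$ write $f(i)=(\pi_0(f(i)),\pi_1(f(i)))$. The multiplicative type of $f$ is $\mathrm{tp}(f)=(p_0,\dots,p_{m-1},\sigma)$ where $p_\ell=|\{i<n:\pi_1(f(i))=\ell\}|$ and $\sigma$ is the total quasiorder on $n$ given by $(i,j)\in\sigma$ iff $\pi_0(f(i))\le\pi_0(f(j))$. An $(n,m)$-multiplicative type is a tuple of the form $\mathrm{tp}(f)$ for some such $f$. It is strict if $\sigma$ is a linear order on $n$ (i.e. $(i,j),(j,i)\in\sigma$ implies $i=j$). $\mathrm{Stp}(n,m)$ is the set of strict $(n,m)$-multiplicative types. -}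

module Defs where

open import Data.Nat using (ℕ; _≤_; _<_; _≤?_)
open import Data.Nat.Properties using ()
open import Data.Fin using (Fin) renaming (_<_ to _<ᶠ_; _≟_ to _≟ᶠ_)
open import Data.Bool using (Bool; true)
open import Data.Product using (Σ; ∃; _×_; _,_; proj₁; proj₂)
open import Data.Sum using (_⊎_)
open import Data.List using (List; length; filter; allFin)
open import Data.Vec using (Vec; tabulate)
open import Relation.Nullary.Decidable using (⌊_⌋)
open import Relation.Binary.PropositionalEquality using (_≡_)

Omega· : ℕ → Set
Omega· m = ℕ × Fin m

_<ω_ : ∀ {m} → Omega· m → Omega· m → Set
(a , ℓ) <ω (b , ℓ') = (ℓ <ᶠ ℓ') ⊎ ((ℓ ≡ ℓ') × (a < b))

IsOrderEmbedding : ∀ {n m} → (Fin n → Omega· m) → Set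
IsOrderEmbedding {n} f = ∀ (i j : Fin n) → i <ᶠ j → f i <ω f j

-- An (n,m)-multiplicative type candidate: (p₀,…,p_{m-1}) and a binary relation σ on n,
-- the relation given by its characteristic matrix (σ i j = true iff (i,j) ∈ σ).
MType : ℕ → ℕ → Set
MType n m = Vec ℕ m × Vec (Vec Bool n) n

tp-p : ∀ {n m} → (Fin n → Omega· m) → Vec ℕ m
tp-p {n} f = tabulate λ ℓ → length (filter (λ i → proj₂ (f i) ≟ᶠ ℓ) (allFin n))

tp-σ : ∀ {n m} → (Fin n → Omega· m) → Vec (Vec Bool n) n
tp-σ f = tabulate λ i → tabulate λ j → ⌊ proj₁ (f i) ≤? proj₁ (f j) ⌋

tp : ∀ {n m} → (Fin n → Omega· m) → MType n m
tp f = tp-p f , tp-σ f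

_∈σ_ : ∀ {n} → Fin n × Fin n → Vec (Vec Bool n) n → Set
(i , j) ∈σ σ = Data.Vec.lookup (Data.Vec.lookup σ i) j ≡ true

IsMType : ∀ n m → MType n m → Set
IsMType n m t = Σ (Fin n → Omega· m) λ f → IsOrderEmbedding f × (tp f ≡ t)

-- strictness: σ antisymmetric (it is then a linear order, being a total quasiorder)
IsStrict : ∀ {n m} → MType n m → Set
IsStrict {n} (p , σ) = ∀ (i j : Fin n) → (i , j) ∈σ σ → (j , i) ∈σ σ → i ≡ j

InStp : ∀ n m → MType n m → Set
InStp n m t = IsMType n m t × IsStrict t

-- A strict type is coded by a word in mⁿ: the levels of the points, read in order of decreasing
-- height. Along an order embedding the levels are monotone, hence determined by the counts p_ℓ,
-- so the type of an embedding records exactly its levels and its height order. Every word is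
-- realised by inserting its points from the lowest up, each new (highest) point going right after
-- the points of level at most its own; removing the highest point of a strict embedding shows, by
-- induction, that every strict type arises from exactly one word.
module Submission where

open import Defs
open import Data.Nat using (ℕ; _≤_; _^_)
open import Data.Product using (Σ; _×_)
open import Data.List using (List; length)
open import Data.List.Relation.Unary.Unique.Propositional using (Unique)
open import Data.List.Membership.Propositional using (_∈_)
open import Function.Bundles using (_⇔_)
open import Relation.Binary.PropositionalEquality using (_≡_)

open import Data.Bool using (true; if_then_else_)
open import Data.Nat using (zero; suc; z≤n; s≤s; _<_; _+_; _*_)
import Data.Nat.Properties as ℕ
open import Data.Fin using (Fin; zero; suc; toℕ; fromℕ<; punchIn; _≟_)
  renaming (_≤_ to _≤ᶠ_; _<_ to _<ᶠ_)
open import Data.Fin.Properties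
  using (toℕ-injective; toℕ-fromℕ<; toℕ<n; punchIn-injective; punchInᵢ≢i; punchIn-punchOut;
         punchIn-mono-≤; punchIn-cancel-≤)
  renaming (_≤?_ to _≤ᶠ?_)
open import Data.Vec using (Vec; []; _∷_; lookup; tabulate)
open import Data.Vec.Properties using (lookup∘tabulate; tabulate-cong; ∷-injective)
open import Data.Vec.Functional using (insertAt)
open import Data.Vec.Functional.Properties using (insertAt-lookup; insertAt-punchIn)
open import Data.List as List using (filter; allFin; map; cartesianProductWith; [_])
open import Data.List.Properties using (length-map; length-++; length-tabulate)
open import Data.List.Relation.Unary.Unique.Propositional.Properties
  using (map⁺; cartesianProductWith⁺; allFin⁺)
open import Data.List.Membership.Propositional.Properties
  using (∈-map⁺; ∈-map⁻; ∈-cartesianProductWith⁺; ∈-allFin)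
open import Data.List.Relation.Unary.Any using (here)
import Data.List.Relation.Unary.All as All
import Data.List.Relation.Unary.AllPairs as AllPairs
open import Data.List.Extrema.Nat using (argmax; f[xs]≤f[argmax])
open import Data.Product using (_,_; proj₁; proj₂; Σ-syntax)
open import Data.Sum using (inj₁; inj₂)
open import Level using (0ℓ)
open import Function using (_∘_; id; const)
open import Function.Bundles using (mk⇔; module Equivalence)
open import Function.Construct.Composition using (_⇔-∘_)
open import Function.Construct.Symmetry using (⇔-sym)
open import Function.Definitions using (Injective)
open import Relation.Binary.Core using (_Preserves_⟶_)
open import Relation.Binary.PropositionalEquality
  using (_≗_; refl; sym; trans; cong; cong₂; subst; subst₂; module ≡-Reasoning)
open import Relation.Nullary using (Dec; yes; no; does; ¬_; contradiction)
open import Relation.Nullary.Decidable using (⌊_⌋; does-⇔; isYes≗does)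
open import Relation.Unary using (Pred; Decidable)

open Equivalence using (to; from)

private
  variable
    n m : ℕ
    f g : Fin n → Omega· m

count : {P : Pred (Fin n) 0ℓ} → Decidable P → ℕ
count {zero}  P? = 0
count {suc n} P? = (if does (P? zero) then 1 else 0) + count (P? ∘ suc)

count≤n : {P : Pred (Fin n) 0ℓ} (P? : Decidable P) → count P? ≤ n
count≤n {n = zero}  P? = z≤n
count≤n {n = suc n} P? with P? zero
... | yes _ = s≤s (count≤n (P? ∘ suc))
... | no  _ = ℕ.m≤n⇒m≤1+n (count≤n (P? ∘ suc))

count≡0 : {P : Pred (Fin n) 0ℓ} (P? : Decidable P) → (∀ i → ¬ P i) → count P? ≡ 0
count≡0 {n = zero}  P? ¬P = refl
count≡0 {n = suc n} P? ¬P with P? zero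
... | yes p = contradiction p (¬P zero)
... | no  _ = count≡0 (P? ∘ suc) (¬P ∘ suc)

count>0 : {P : Pred (Fin n) 0ℓ} (P? : Decidable P) {i : Fin n} → P i → 0 < count P?
count>0 {n = suc n} P? p with P? zero
... | yes _ = s≤s z≤n
count>0 {n = suc n} P? {zero}  p | no ¬p = contradiction p ¬p
count>0 {n = suc n} P? {suc i} p | no _  = count>0 (P? ∘ suc) p

count-cong : {P Q : Pred (Fin n) 0ℓ} (P? : Decidable P) (Q? : Decidable Q) →
             (∀ i → P i ⇔ Q i) → count P? ≡ count Q?
count-cong {n = zero}  P? Q? P⇔Q = refl
count-cong {n = suc n} P? Q? P⇔Q =
  cong₂ (λ b c → (if b then 1 else 0) + c)
        (does-⇔ (P⇔Q zero) (P? zero) (Q? zero))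
        (count-cong (P? ∘ suc) (Q? ∘ suc) (P⇔Q ∘ suc))

count-downClosed : {P : Pred (Fin n) 0ℓ} (P? : Decidable P) →
                   (∀ {i j} → i ≤ᶠ j → P j → P i) → ∀ i → P i ⇔ toℕ i < count P?
count-downClosed {n = suc n} {P} P? closed i with P? zero
count-downClosed {n = suc n} {P} P? closed zero    | yes p = mk⇔ (const (s≤s z≤n)) (const p)
count-downClosed {n = suc n} {P} P? closed (suc i) | yes _ =
  mk⇔ (s≤s ∘ to P⇔) (from P⇔ ∘ ℕ.≤-pred)
  where
  P⇔ : P (suc i) ⇔ toℕ i < count (P? ∘ suc)
  P⇔ = count-downClosed (P? ∘ suc) (λ i≤j → closed (s≤s i≤j)) i
count-downClosed {n = suc n} {P} P? closed i       | no ¬p₀ =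
  mk⇔ (λ p → contradiction (closed z≤n p) ¬p₀)
      (λ i<c → contradiction (subst (toℕ i <_) nothing-after-zero i<c) ℕ.n≮0)
  where
  nothing-after-zero : count (P? ∘ suc) ≡ 0
  nothing-after-zero = count≡0 (P? ∘ suc) (λ j p → ¬p₀ (closed z≤n p))

count≡ : {P : Pred (Fin n) 0ℓ} (P? : Decidable P) {a : ℕ} → a ≤ n →
         (∀ i → P i ⇔ toℕ i < a) → count P? ≡ a
count≡ {n = zero}  P? z≤n P⇔ = refl
count≡ {n = suc n} P? a≤n P⇔ with P? zero
count≡ {n = suc n} P? {zero}  a≤n       P⇔ | yes p  = contradiction (to (P⇔ zero) p) ℕ.n≮0
count≡ {n = suc n} P? {suc a} (s≤s a≤n) P⇔ | yes _  =
  cong suc (count≡ (P? ∘ suc) a≤n λ i → mk⇔ (ℕ.≤-pred ∘ to (P⇔ (suc i))) (from (P⇔ (suc i)) ∘ s≤s))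
count≡ {n = suc n} P? {zero}  a≤n       P⇔ | no _   =
  count≡ (P? ∘ suc) z≤n (λ i → mk⇔ (λ p → contradiction (to (P⇔ (suc i)) p) ℕ.n≮0) (λ ()))
count≡ {n = suc n} P? {suc a} a≤n       P⇔ | no ¬p₀ = contradiction (from (P⇔ zero) (s≤s z≤n)) ¬p₀

length-filter-tabulate : {A : Set} {P : Pred A 0ℓ} (P? : Decidable P) (g : Fin n → A) →
                         length (filter P? (List.tabulate g)) ≡ count (P? ∘ g)
length-filter-tabulate {n = zero}  P? g = refl
length-filter-tabulate {n = suc n} P? g with P? (g zero)
... | yes _ = cong suc (length-filter-tabulate P? (g ∘ suc))
... | no  _ = length-filter-tabulate P? (g ∘ suc)

fibreSize : (Fin n → Fin m) → Fin m → ℕ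
fibreSize a ℓ = count (λ i → a i ≟ ℓ)

Monotone : (Fin n → Fin m) → Set
Monotone a = a Preserves _≤ᶠ_ ⟶ _≤ᶠ_

monotone-head-≤ : (a b : Fin (suc n) → Fin m) → Monotone b →
                  (∀ ℓ → fibreSize a ℓ ≡ fibreSize b ℓ) → b zero ≤ᶠ a zero
monotone-head-≤ a b b↑ same = ℕ.≮⇒≥ λ a₀<b₀ →
  ℕ.<⇒≢ (count>0 (λ i → a i ≟ a zero) {zero} refl)
        (sym (trans (same (a zero)) (count≡0 (λ i → b i ≟ a zero) (λ i bᵢ≡a₀ →
          ℕ.<⇒≱ a₀<b₀ (subst (b zero ≤ᶠ_) bᵢ≡a₀ (b↑ z≤n))))))

monotone-fibreSize-injective : (a b : Fin n → Fin m) → Monotone a → Monotone b →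
                               (∀ ℓ → fibreSize a ℓ ≡ fibreSize b ℓ) → a ≗ b
monotone-fibreSize-injective {suc n} a b a↑ b↑ same = λ where
    zero    → a₀≡b₀
    (suc i) → monotone-fibreSize-injective (a ∘ suc) (b ∘ suc) (a↑ ∘ s≤s) (b↑ ∘ s≤s) same-tail i
  where
  a₀≡b₀ : a zero ≡ b zero
  a₀≡b₀ = toℕ-injective
    (ℕ.≤-antisym (monotone-head-≤ b a a↑ (sym ∘ same)) (monotone-head-≤ a b b↑ same))
  same-tail : ∀ ℓ → fibreSize (a ∘ suc) ℓ ≡ fibreSize (b ∘ suc) ℓ
  same-tail ℓ = ℕ.+-cancelˡ-≡ (if does (b zero ≟ ℓ) then 1 else 0) _ _
    (subst (λ x → (if does (x ≟ ℓ) then 1 else 0) + fibreSize (a ∘ suc) ℓ ≡ fibreSize b ℓ)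
           a₀≡b₀ (same ℓ))

height : (Fin n → Omega· m) → Fin n → ℕ
height f = proj₁ ∘ f

level : (Fin n → Omega· m) → Fin n → Fin m
level f = proj₂ ∘ f

record SameType (f g : Fin n → Omega· m) : Set where
  constructor sameType
  field
    levels  : level f ≗ level g
    heights : ∀ i j → height f i ≤ height f j ⇔ height g i ≤ height g j

open SameType

≗⇒SameType : f ≗ g → SameType f g
≗⇒SameType f≗g = sameType (cong proj₂ ∘ f≗g) λ i j →
  mk⇔ (subst₂ _≤_ (cong proj₁ (f≗g i)) (cong proj₁ (f≗g j)))
      (subst₂ _≤_ (cong proj₁ (sym (f≗g i))) (cong proj₁ (sym (f≗g j))))

SameType-sym : SameType f g → SameType g f
SameType-sym (sameType l h) = sameType (sym ∘ l) (λ i j → ⇔-sym (h i j))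

SameType-trans : {e : Fin n → Omega· m} → SameType f g → SameType g e → SameType f e
SameType-trans (sameType l h) (sameType l′ h′) =
  sameType (λ i → trans (l i) (l′ i)) (λ i j → h′ i j ⇔-∘ h i j)

SameType-∘ : {n′ : ℕ} (r : Fin n′ → Fin n) → SameType f g → SameType (f ∘ r) (g ∘ r)
SameType-∘ r (sameType l h) = sameType (l ∘ r) (λ i j → h (r i) (r j))

lookup-tp-p : (f : Fin n → Omega· m) (ℓ : Fin m) → lookup (tp-p f) ℓ ≡ fibreSize (level f) ℓ
lookup-tp-p f ℓ = trans (lookup∘tabulate _ ℓ) (length-filter-tabulate (λ i → level f i ≟ ℓ) id)

⌊⌋≡true⇔ : {A : Set} (a? : Dec A) → ⌊ a? ⌋ ≡ true ⇔ A
⌊⌋≡true⇔ (yes a) = mk⇔ (const a) (const refl)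
⌊⌋≡true⇔ (no ¬a) = mk⇔ (λ ()) (λ a → contradiction a ¬a)

⌊⌋-⇔ : {A B : Set} → A ⇔ B → (a? : Dec A) (b? : Dec B) → ⌊ a? ⌋ ≡ ⌊ b? ⌋
⌊⌋-⇔ A⇔B a? b? = trans (isYes≗does a?) (trans (does-⇔ A⇔B a? b?) (sym (isYes≗does b?)))

∈σ-tp-σ⇔ : (f : Fin n → Omega· m) (i j : Fin n) → (i , j) ∈σ tp-σ f ⇔ height f i ≤ height f j
∈σ-tp-σ⇔ f i j =
  subst (λ b → b ≡ true ⇔ height f i ≤ height f j) (sym lookup-tp-σ) (⌊⌋≡true⇔ (height f i ℕ.≤? height f j))
  where
  lookup-tp-σ : lookup (lookup (tp-σ f) i) j ≡ ⌊ height f i ℕ.≤? height f j ⌋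
  lookup-tp-σ = trans (cong (λ row → lookup row j) (lookup∘tabulate _ i)) (lookup∘tabulate _ j)

tp-cong : SameType f g → tp f ≡ tp g
tp-cong {f = f} {g} (sameType l h) = cong₂ _,_
  (tabulate-cong λ ℓ → begin
     length (filter (λ i → level f i ≟ ℓ) (allFin _))
       ≡⟨ length-filter-tabulate (λ i → level f i ≟ ℓ) id ⟩
     fibreSize (level f) ℓ
       ≡⟨ count-cong _ _ (λ i → mk⇔ (trans (sym (l i))) (trans (l i))) ⟩
     fibreSize (level g) ℓ
       ≡⟨ length-filter-tabulate (λ i → level g i ≟ ℓ) id ⟨
     length (filter (λ i → level g i ≟ ℓ) (allFin _)) ∎)
  (tabulate-cong λ i → tabulate-cong λ j → ⌊⌋-⇔ (h i j) _ _)
  where open ≡-Reasoning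

level-monotone : IsOrderEmbedding f → Monotone (level f)
level-monotone {f = f} f↪ {i} {j} i≤j with ℕ.m≤n⇒m<n∨m≡n i≤j
... | inj₂ i≡j = ℕ.≤-reflexive (cong (toℕ ∘ level f) (toℕ-injective i≡j))
... | inj₁ i<j with f↪ i j i<j
...   | inj₁ lᵢ<lⱼ       = ℕ.<⇒≤ lᵢ<lⱼ
...   | inj₂ (lᵢ≡lⱼ , _) = ℕ.≤-reflexive (cong toℕ lᵢ≡lⱼ)

tp-injective : IsOrderEmbedding f → IsOrderEmbedding g → tp f ≡ tp g → SameType f g
tp-injective {f = f} {g} f↪ g↪ f≡g = sameType
  (monotone-fibreSize-injective (level f) (level g) (level-monotone f↪) (level-monotone g↪) λ ℓ →
     trans (sym (lookup-tp-p f ℓ)) (trans (cong (λ t → lookup (proj₁ t) ℓ) f≡g) (lookup-tp-p g ℓ)))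
  (λ i j → ∈σ-tp-σ⇔ g i j ⇔-∘ (same-σ i j ⇔-∘ ⇔-sym (∈σ-tp-σ⇔ f i j)))
  where
  same-σ : ∀ i j → (i , j) ∈σ tp-σ f ⇔ (i , j) ∈σ tp-σ g
  same-σ i j = mk⇔ (subst (λ t → (i , j) ∈σ proj₂ t) f≡g)
                   (subst (λ t → (i , j) ∈σ proj₂ t) (sym f≡g))

strict⇔height-injective : (f : Fin n → Omega· m) → IsStrict (tp f) ⇔ Injective _≡_ _≡_ (height f)
strict⇔height-injective f = mk⇔
  (λ strict {i} {j} hᵢ≡hⱼ → strict i j (from (∈σ-tp-σ⇔ f i j) (ℕ.≤-reflexive hᵢ≡hⱼ))
                                         (from (∈σ-tp-σ⇔ f j i) (ℕ.≤-reflexive (sym hᵢ≡hⱼ))))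
  (λ inj i j ij ji → inj (ℕ.≤-antisym (to (∈σ-tp-σ⇔ f i j) ij) (to (∈σ-tp-σ⇔ f j i) ji)))

level-≤-highest⇔ : IsOrderEmbedding f → {i : Fin n} →
                   (∀ j → height f j ≤ height f i) → ∀ j → level f j ≤ᶠ level f i ⇔ j ≤ᶠ i
level-≤-highest⇔ {f = f} f↪ {i} highest j =
  mk⇔ (λ lⱼ≤lᵢ → ℕ.≮⇒≥ λ i<j → not-above (f↪ i j i<j) lⱼ≤lᵢ) (level-monotone f↪)
  where
  not-above : f i <ω f j → ¬ level f j ≤ᶠ level f i
  not-above (inj₁ lᵢ<lⱼ)      = ℕ.<⇒≱ lᵢ<lⱼ
  not-above (inj₂ (_ , hᵢ<hⱼ)) = const (ℕ.<⇒≱ hᵢ<hⱼ (highest j))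

data PunchInView (k : Fin (suc n)) : Fin (suc n) → Set where
  at      : PunchInView k k
  punched : (j : Fin n) → PunchInView k (punchIn k j)

punchInView : (k i : Fin (suc n)) → PunchInView k i
punchInView k i with i ≟ k
... | yes refl = at
... | no  i≢k  = subst (PunchInView k) (punchIn-punchOut (i≢k ∘ sym)) (punched _)

punchIn-≤⇔< : (k : Fin (suc n)) (j : Fin n) → punchIn k j ≤ᶠ k ⇔ j <ᶠ k
punchIn-≤⇔< zero    j       = mk⇔ (λ ()) (λ ())
punchIn-≤⇔< (suc k) zero    = mk⇔ (const (s≤s z≤n)) (const z≤n)
punchIn-≤⇔< (suc k) (suc j) = mk⇔ (s≤s ∘ to IH ∘ ℕ.≤-pred) (s≤s ∘ from IH ∘ ℕ.≤-pred)
  where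
  IH : punchIn k j ≤ᶠ k ⇔ j <ᶠ k
  IH = punchIn-≤⇔< k j

punchIn-mono-< : (k : Fin (suc n)) (i j : Fin n) → i <ᶠ j → punchIn k i <ᶠ punchIn k j
punchIn-mono-< k i j i<j = ℕ.≰⇒> λ kj≤ki → ℕ.<⇒≱ i<j (punchIn-cancel-≤ k j i kj≤ki)

punchIn-cancel-< : (k : Fin (suc n)) (i j : Fin n) → punchIn k i <ᶠ punchIn k j → i <ᶠ j
punchIn-cancel-< k i j ki<kj = ℕ.≰⇒> λ j≤i → ℕ.<⇒≱ ki<kj (punchIn-mono-≤ k j i j≤i)

module Insertion (g : Fin n → Omega· m) (k : Fin (suc n)) (N : ℕ) (c : Fin m) where

  g⁺ : Fin (suc n) → Omega· m
  g⁺ = insertAt g k (N , c)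

  at-k : g⁺ k ≡ (N , c)
  at-k = insertAt-lookup g k (N , c)

  at-punchIn : g⁺ ∘ punchIn k ≗ g
  at-punchIn = insertAt-punchIn g k (N , c)

  module _ (height<N : ∀ j → height g j < N) where

    height≤N : ∀ i → height g⁺ i ≤ N
    height≤N i with punchInView k i
    ... | at        rewrite at-k         = ℕ.≤-refl
    ... | punched j rewrite at-punchIn j = ℕ.<⇒≤ (height<N j)

    highest-unique : ∀ {i} → (∀ j → height g⁺ j ≤ height g⁺ i) → i ≡ k
    highest-unique {i} highest with punchInView k i
    ... | at        = refl
    ... | punched j = contradiction (subst₂ _≤_ (cong proj₁ at-k) (cong proj₁ (at-punchIn j)) (highest k))
                                    (ℕ.<⇒≱ (height<N j))

    height-injective : Injective _≡_ _≡_ (height g) → Injective _≡_ _≡_ (height g⁺)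
    height-injective inj {i} {i′} hᵢ≡hᵢ′ with punchInView k i | punchInView k i′
    ... | at        | at         = refl
    ... | at        | punched j′ rewrite at-k | at-punchIn j′ =
      contradiction (height<N j′) (ℕ.<-irrefl (sym hᵢ≡hᵢ′))
    ... | punched j | at         rewrite at-k | at-punchIn j  =
      contradiction (height<N j) (ℕ.<-irrefl hᵢ≡hᵢ′)
    ... | punched j | punched j′ rewrite at-punchIn j | at-punchIn j′ =
      cong (punchIn k) (inj hᵢ≡hᵢ′)

    isOrderEmbedding : IsOrderEmbedding g → (∀ j → level g j ≤ᶠ c ⇔ j <ᶠ k) → IsOrderEmbedding g⁺
    isOrderEmbedding g↪ split i i′ i<i′ with punchInView k i | punchInView k i′
    ... | at        | at         = contradiction i<i′ (ℕ.<-irrefl refl)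
    ... | at        | punched j′ rewrite at-k | at-punchIn j′ =
      inj₁ (ℕ.≰⇒> λ lⱼ′≤c → ℕ.<⇒≱ i<i′ (from (punchIn-≤⇔< k j′) (to (split j′) lⱼ′≤c)))
    ... | punched j | at         rewrite at-k | at-punchIn j
      with ℕ.m≤n⇒m<n∨m≡n (from (split j) (to (punchIn-≤⇔< k j) (ℕ.<⇒≤ i<i′)))
    ...   | inj₁ lⱼ<c = inj₁ lⱼ<c
    ...   | inj₂ lⱼ≡c = inj₂ (toℕ-injective lⱼ≡c , height<N j)
    isOrderEmbedding g↪ split i i′ i<i′ | punched j | punched j′ rewrite at-punchIn j | at-punchIn j′ =
      g↪ j j′ (punchIn-cancel-< k j j′ i<i′)

    sameType-extend : (f : Fin (suc n) → Omega· m) → level f k ≡ c →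
                      (∀ j → height f (punchIn k j) < height f k) →
                      SameType (f ∘ punchIn k) g → SameType f g⁺
    sameType-extend f lₖ≡c below (sameType l h) = sameType levels′ heights′
      where
      levels′ : level f ≗ level g⁺
      levels′ i with punchInView k i
      ... | at        rewrite at-k         = lₖ≡c
      ... | punched j rewrite at-punchIn j = l j
      heights′ : ∀ i i′ → height f i ≤ height f i′ ⇔ height g⁺ i ≤ height g⁺ i′
      heights′ i i′ with punchInView k i | punchInView k i′
      ... | at        | at         = mk⇔ (const ℕ.≤-refl) (const ℕ.≤-refl)
      ... | at        | punched j′ rewrite at-k | at-punchIn j′ =
        mk⇔ (λ p → contradiction p (ℕ.<⇒≱ (below j′))) (λ p → contradiction p (ℕ.<⇒≱ (height<N j′)))
      ... | punched j | at         rewrite at-k | at-punchIn j =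
        mk⇔ (const (ℕ.<⇒≤ (height<N j))) (const (ℕ.<⇒≤ (below j)))
      ... | punched j | punched j′ rewrite at-punchIn j | at-punchIn j′ = h j j′

insertion-SameType⁻ : {g g′ : Fin n → Omega· m} {k k′ : Fin (suc n)} {N : ℕ} {c c′ : Fin m} →
  (∀ j → height g j < N) → (∀ j → height g′ j < N) →
  SameType (Insertion.g⁺ g k N c) (Insertion.g⁺ g′ k′ N c′) → c ≡ c′ × SameType g g′
insertion-SameType⁻ {g = g} {g′} {k} {k′} {N} {c} {c′} g<N g′<N s =
  restrict (I′.highest-unique g′<N highest-in-g′⁺)
  where
  module I  = Insertion g  k  N c
  module I′ = Insertion g′ k′ N c′
  highest-in-g′⁺ : ∀ j → height I′.g⁺ j ≤ height I′.g⁺ k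
  highest-in-g′⁺ j =
    to (heights s j k) (subst (height I.g⁺ j ≤_) (sym (cong proj₁ I.at-k)) (I.height≤N g<N j))
  restrict : k ≡ k′ → c ≡ c′ × SameType g g′
  restrict refl = trans (sym (cong proj₂ I.at-k)) (trans (levels s k) (cong proj₂ I′.at-k))
                , SameType-trans (SameType-sym (≗⇒SameType I.at-punchIn))
                                 (SameType-trans (SameType-∘ (punchIn k) s) (≗⇒SameType I′.at-punchIn))

slot : (Fin n → Omega· m) → Fin m → Fin (suc n)
slot g c = fromℕ< (s≤s (count≤n (λ j → level g j ≤ᶠ? c)))

slot-split : IsOrderEmbedding g → ∀ c j → level g j ≤ᶠ c ⇔ j <ᶠ slot g c
slot-split {g = g} g↪ c j rewrite toℕ-fromℕ< (s≤s (count≤n (λ j → level g j ≤ᶠ? c))) =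
  count-downClosed (λ j → level g j ≤ᶠ? c) (λ i≤j lⱼ≤c → ℕ.≤-trans (level-monotone g↪ i≤j) lⱼ≤c) j

slot-unique : {c : Fin m} {k : Fin (suc n)} → (∀ j → level g j ≤ᶠ c ⇔ j <ᶠ k) → slot g c ≡ k
slot-unique {g = g} {c} {k} split = toℕ-injective (trans (toℕ-fromℕ< _)
  (count≡ (λ j → level g j ≤ᶠ? c) (ℕ.≤-pred (toℕ<n k)) split))

canonical : Vec (Fin m) n → Fin n → Omega· m
canonical {n = zero}  []      ()
canonical {n = suc n} (c ∷ w) = Insertion.g⁺ (canonical w) (slot (canonical w) c) n c

module Step {n m : ℕ} (c : Fin m) (w : Vec (Fin m) n) = Insertion (canonical w) (slot (canonical w) c) n c

canonical-height< : (w : Vec (Fin m) n) → ∀ j → height (canonical w) j < n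
canonical-height< (c ∷ w) j = s≤s (Step.height≤N c w (canonical-height< w) j)

canonical-height-injective : (w : Vec (Fin m) n) → Injective _≡_ _≡_ (height (canonical w))
canonical-height-injective []      {()}
canonical-height-injective (c ∷ w) =
  Step.height-injective c w (canonical-height< w) (canonical-height-injective w)

canonical-isOrderEmbedding : (w : Vec (Fin m) n) → IsOrderEmbedding (canonical w)
canonical-isOrderEmbedding (c ∷ w) = Step.isOrderEmbedding c w (canonical-height< w) w↪ (slot-split w↪ c)
  where
  w↪ : IsOrderEmbedding (canonical w)
  w↪ = canonical-isOrderEmbedding w

canonical-SameType-injective : (w w′ : Vec (Fin m) n) → SameType (canonical w) (canonical w′) → w ≡ w′
canonical-SameType-injective []      []        _ = refl
canonical-SameType-injective (c ∷ w) (c′ ∷ w′) s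
  with c≡c′ , s′ ← insertion-SameType⁻ {k = slot (canonical w) c} {slot (canonical w′) c′}
                                       (canonical-height< w) (canonical-height< w′) s
  = cong₂ _∷_ c≡c′ (canonical-SameType-injective w w′ s′)

canonical-complete : (f : Fin n → Omega· m) → IsOrderEmbedding f → Injective _≡_ _≡_ (height f) →
                     Σ[ w ∈ Vec (Fin m) n ] SameType f (canonical w)
canonical-complete {n = zero}      f f↪ inj = [] , sameType (λ ()) (λ ())
canonical-complete {n = suc n} {m} f f↪ inj =
  level f top ∷ w ,
  subst (λ k → SameType f (Insertion.g⁺ (canonical w) k n (level f top))) (sym slot≡top)
        (Insertion.sameType-extend (canonical w) top n (level f top) (canonical-height< w)
                                   f refl strictly-highest f′~w)
  where
  top : Fin (suc n)
  top = argmax (height f) zero (allFin _)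
  highest : ∀ j → height f j ≤ height f top
  highest j = All.lookup (f[xs]≤f[argmax] {f = height f} zero (allFin _)) (∈-allFin j)
  strictly-highest : ∀ j → height f (punchIn top j) < height f top
  strictly-highest j = ℕ.≤∧≢⇒< (highest _) (punchInᵢ≢i top j ∘ inj)
  f′ : Fin n → Omega· m
  f′ = f ∘ punchIn top
  f′-realised : Σ[ w ∈ Vec (Fin m) n ] SameType f′ (canonical w)
  f′-realised =
    canonical-complete f′ (λ i j → f↪ _ _ ∘ punchIn-mono-< top i j) (punchIn-injective top _ _ ∘ inj)
  w : Vec (Fin m) n
  w = proj₁ f′-realised
  f′~w : SameType f′ (canonical w)
  f′~w = proj₂ f′-realised
  slot≡top : slot (canonical w) (level f top) ≡ top
  slot≡top = slot-unique {g = canonical w} λ j →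
    subst (λ l → l ≤ᶠ level f top ⇔ j <ᶠ top) (levels f′~w j)
          (punchIn-≤⇔< top j ⇔-∘ level-≤-highest⇔ f↪ highest (punchIn top j))

length-cartesianProductWith : {A B C : Set} (f : A → B → C) (xs : List A) (ys : List B) →
                              length (cartesianProductWith f xs ys) ≡ length xs * length ys
length-cartesianProductWith f List.[]       ys = refl
length-cartesianProductWith f (x List.∷ xs) ys = begin
  length (map (f x) ys List.++ cartesianProductWith f xs ys)
    ≡⟨ length-++ (map (f x) ys) ⟩
  length (map (f x) ys) + length (cartesianProductWith f xs ys)
    ≡⟨ cong₂ _+_ (length-map (f x) ys) (length-cartesianProductWith f xs ys) ⟩
  length ys + length xs * length ys ∎
  where open ≡-Reasoning

words : ∀ m n → List (Vec (Fin m) n)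
words m zero    = [ [] ]
words m (suc n) = cartesianProductWith _∷_ (allFin m) (words m n)

words-unique : ∀ m n → Unique (words m n)
words-unique m zero    = All.[] AllPairs.∷ AllPairs.[]
words-unique m (suc n) = cartesianProductWith⁺ _∷_ ∷-injective (allFin⁺ m) (words-unique m n)

∈-words : (w : Vec (Fin m) n) → w ∈ words m n
∈-words []      = here refl
∈-words (c ∷ w) = ∈-cartesianProductWith⁺ _∷_ (∈-allFin c) (∈-words w)

length-words : ∀ m n → length (words m n) ≡ m ^ n
length-words m zero    = refl
length-words m (suc n) = begin
  length (words m (suc n))               ≡⟨ length-cartesianProductWith _∷_ (allFin m) (words m n) ⟩
  length (allFin m) * length (words m n) ≡⟨ cong₂ _*_ (length-tabulate {n = m} id) (length-words m n) ⟩
  m * m ^ n                              ∎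
  where open ≡-Reasoning

tp∘canonical-injective : {w w′ : Vec (Fin m) n} → tp (canonical w) ≡ tp (canonical w′) → w ≡ w′
tp∘canonical-injective {w = w} {w′} =
  canonical-SameType-injective w w′
  ∘ tp-injective (canonical-isOrderEmbedding w) (canonical-isOrderEmbedding w′)

lemma4p7 : ∀ (n m : ℕ) → 1 ≤ n → 1 ≤ m →
    Σ (List (MType n m)) λ L →
      Unique L × (∀ (t : MType n m) → (t ∈ L ⇔ InStp n m t)) × (length L ≡ m ^ n)
lemma4p7 n m _ _ =
  map (tp ∘ canonical) (words m n) ,
  map⁺ tp∘canonical-injective (words-unique m n) ,
  (λ t → mk⇔ (realised-type-is-strict t) (strict-type-is-realised t)) ,
  trans (length-map _ (words m n)) (length-words m n)
  where
  realised-type-is-strict : ∀ t → t ∈ map (tp ∘ canonical) (words m n) → InStp n m t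
  realised-type-is-strict t t∈ with w , _ , refl ← ∈-map⁻ (tp ∘ canonical) t∈ =
    (canonical w , canonical-isOrderEmbedding w , refl) ,
    from (strict⇔height-injective (canonical w)) (canonical-height-injective w)
  strict-type-is-realised : ∀ t → InStp n m t → t ∈ map (tp ∘ canonical) (words m n)
  strict-type-is-realised t ((f , f↪ , refl) , strict)
    with w , f~w ← canonical-complete f f↪ (to (strict⇔height-injective f) strict) =
    subst (_∈ map (tp ∘ canonical) (words m n)) (sym (tp-cong f~w))
          (∈-map⁺ (tp ∘ canonical) (∈-words w))
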